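{- Let $\vec p,\vec q$ be lists of propositional variables, $q$ a propositional variable, $k$ an integer, and write $\vec p q\vec q$ and $q\vec p\vec q$ for list concatenations. There are $\mathsf{posELNDT}$ proofs over the extension axioms $\mathcal T$, of size polynomial in the size of the sequent, of both $t^{\vec p q\vec q}_k\to t^{q\vec p\vec q}_k$ and $t^{q\vec p\vec q}_k\to t^{\vec p q\vec q}_k$.
   Context: eNDT formulas: built from propositional variables, constants $0,1$ and extension variables by $\vee$ and decisions $\mathrm{dec}(A,p,B)$ ("if $p$ then $B$ else $A$", $p$ a propositional variable). $\mathrm{pd}(A,p,C):=\mathrm{dec}(A,p,A\vee C)$; positive formulas have only decisions of this form. An extension axiom $e\leftrightarrow A$ stands for sequents $e\to A$ and $A\to e$. Threshold axioms $\mathcal T$: for every list $\vec p$ of propositional variables and integer $k$, an extension variable $t^{\vec p}_k$, with axioms $t^{\epsilon}_0\leftrightarrow1$, $t^{\epsilon}_k\leftrightarrow0$ ($k\ne0$), $t^{p\vec p}_k\leftrightarrow\mathrm{pd}(t^{\vec p}_k,p,t^{\vec p}_{k-1})$ ($\epsilon$ empty list; $p\vec p$ = $\vec p$ with $p$ prepended). $\mathsf{posELNDT}$: sequents on multisets; initial sequents $0\to$, $\to1$, $p\to p$; cut; left/right weakening and contraction; $\vee$-left (from $\Gamma,A\to\Delta$ and $\Gamma,B\to\Delta$ infer $\Gamma,A\vee B\to\Delta$); $\vee$-right (from $\Gamma\to\Delta,A,B$ infer $\Gamma\to\Delta,A\vee B$); positive decision left (from $\Gamma,A\to\Delta$ and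 $\Gamma,p,B\to\Delta$ infer $\Gamma,\mathrm{pd}(A,p,B)\to\Delta$) and right (from $\Gamma\to\Delta,A,p$ and $\Gamma\to\Delta,A,B$ infer $\Gamma\to\Delta,\mathrm{pd}(A,p,B)$); all formulas positive. A proof over a set of extension axioms: finite list of sequents, each an axiom sequent or derived by a rule (conclusion may contain extension variables). Size = number of symbols. -}

module Defs where

open import Data.Nat using (ℕ; zero; suc; _+_; _*_; _^_; _≤_)
open import Data.Nat.Logarithm using (⌊log₂_⌋)
open import Data.Integer as ℤ using (ℤ; ∣_∣; 0ℤ; 1ℤ)
open import Data.List using (List; []; _∷_; _++_; length)
open import Data.List.Relation.Binary.Permutation.Propositional using (_↭_)
open import Data.List.Relation.Unary.All using (All)
open import Data.List.Relation.Unary.Any using (Any)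
open import Data.Product using (Σ; _×_; ∃)
open import Relation.Binary.PropositionalEquality using (_≡_)
open import Relation.Nullary using (¬_)

-- Extension variables are the threshold variables t^{ps}_k (the only
-- extension variables having axioms in 𝒯); `ext ps k` denotes t^{ps}_k.

PVar : Set
PVar = ℕ

data Form : Set where
  var  : PVar → Form
  𝟎 𝟏  : Form
  ext  : List PVar → ℤ → Form
  _∨_  : Form → Form → Form
  dec  : Form → PVar → Form → Form   -- dec(A,p,B): if p then B else A

pd : Form → PVar → Form → Form
pd A p C = dec A p (A ∨ C)

data Positive : Form → Set where
  pos-var : ∀ p → Positive (var p)
  pos-0   : Positive 𝟎
  pos-1   : Positive 𝟏
  pos-ext : ∀ ps k → Positive (ext ps k)
  pos-∨   : ∀ {A B} → Positive A → Positive B → Positive (A ∨ B)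
  pos-pd  : ∀ {A C} p → Positive A → Positive C → Positive (pd A p C)

-- Sequents (antecedent and succedent are multisets, represented by lists
-- taken up to permutation).

record Seq : Set where
  constructor _⇒_
  field
    ant : List Form
    succ : List Form
open Seq public

infix 4 _≈S_
_≈S_ : Seq → Seq → Set
S ≈S S' = (ant S ↭ ant S') × (succ S ↭ succ S')

PositiveSeq : Seq → Set
PositiveSeq S = All Positive (ant S) × All Positive (succ S)

data TAx : Form → Form → Set where
  t-nil-0   : TAx (ext [] 0ℤ) 𝟏
  t-nil-k   : ∀ {k} → ¬ (k ≡ 0ℤ) → TAx (ext [] k) 𝟎
  t-cons    : ∀ p ps k →
              TAx (ext (p ∷ ps) k) (pd (ext ps k) p (ext ps (k ℤ.- 1ℤ)))

-- Inferences of posELNDT over 𝒯: `Inf premises conclusion`.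
-- Γ,A is written A ∷ Γ; sequents are compared up to multiset equality
-- when the rules are applied (see `Valid`).

data Inf : List Seq → Seq → Set where
  init-0 : Inf [] ((𝟎 ∷ []) ⇒ [])
  init-1 : Inf [] ([] ⇒ (𝟏 ∷ []))
  init-p : ∀ p → Inf [] ((var p ∷ []) ⇒ (var p ∷ []))
  ax-→   : ∀ {e A} → TAx e A → Inf [] ((e ∷ []) ⇒ (A ∷ []))
  ax-←   : ∀ {e A} → TAx e A → Inf [] ((A ∷ []) ⇒ (e ∷ []))
  cut    : ∀ Γ Δ A →
           Inf ((Γ ⇒ (A ∷ Δ)) ∷ ((A ∷ Γ) ⇒ Δ) ∷ []) (Γ ⇒ Δ)
  weak-l : ∀ Γ Δ A → Inf ((Γ ⇒ Δ) ∷ []) ((A ∷ Γ) ⇒ Δ)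
  weak-r : ∀ Γ Δ A → Inf ((Γ ⇒ Δ) ∷ []) (Γ ⇒ (A ∷ Δ))
  contr-l : ∀ Γ Δ A → Inf (((A ∷ A ∷ Γ) ⇒ Δ) ∷ []) ((A ∷ Γ) ⇒ Δ)
  contr-r : ∀ Γ Δ A → Inf ((Γ ⇒ (A ∷ A ∷ Δ)) ∷ []) (Γ ⇒ (A ∷ Δ))
  ∨-l    : ∀ Γ Δ A B →
           Inf (((A ∷ Γ) ⇒ Δ) ∷ ((B ∷ Γ) ⇒ Δ) ∷ []) (((A ∨ B) ∷ Γ) ⇒ Δ)
  ∨-r    : ∀ Γ Δ A B →
           Inf ((Γ ⇒ (A ∷ B ∷ Δ)) ∷ []) (Γ ⇒ ((A ∨ B) ∷ Δ))
  pd-l   : ∀ Γ Δ A p B →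
           Inf (((A ∷ Γ) ⇒ Δ) ∷ ((var p ∷ B ∷ Γ) ⇒ Δ) ∷ [])
               ((pd A p B ∷ Γ) ⇒ Δ)
  pd-r   : ∀ Γ Δ A p B →
           Inf ((Γ ⇒ (A ∷ var p ∷ Δ)) ∷ (Γ ⇒ (A ∷ B ∷ Δ)) ∷ [])
               (Γ ⇒ (pd A p B ∷ Δ))

Valid : List Seq → Seq → Set
Valid prev S =
  Σ (List Seq) λ Ps → Σ Seq λ C →
    Inf Ps C × All (λ P → Any (λ L → P ≈S L) prev) Ps × (S ≈S C)

-- A proof is a finite list of sequents; we store it newest-first, so
-- `Deriv (S ∷ prev)` requires S to be valid w.r.t. the earlier lines prev.
data Deriv : List Seq → Set where
  []  : Deriv []
  _∷_ : ∀ {S prev} → PositiveSeq S × Valid prev S → Deriv prev → Deriv (S ∷ prev)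

ProofOf : Seq → Set
ProofOf S = Σ (List Seq) λ lines → Deriv lines × Any (λ L → L ≈S S) lines

-- Size = number of symbols.
-- An integer index k is counted by its binary length (plus sign);
-- the extension variable t^{ps}_k counts 1 + |ps| + bitlength(k).

sizeℤ : ℤ → ℕ
sizeℤ k = suc (suc ⌊log₂ (suc ∣ k ∣) ⌋)

sizeF : Form → ℕ
sizeF (var p)    = 1
sizeF 𝟎          = 1
sizeF 𝟏          = 1
sizeF (ext ps k) = suc (length ps + sizeℤ k)
sizeF (A ∨ B)    = suc (sizeF A + sizeF B)
sizeF (dec A p B) = suc (suc (sizeF A + sizeF B))

sizeFs : List Form → ℕ
sizeFs []       = 0
sizeFs (A ∷ As) = sizeF A + sizeFs As

sizeSeq : Seq → ℕ
sizeSeq S = suc (sizeFs (ant S) + sizeFs (succ S))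

sizeLines : List Seq → ℕ
sizeLines []       = 0
sizeLines (S ∷ Ss) = sizeSeq S + sizeLines Ss

sizeProof : ∀ {S} → ProofOf S → ℕ
sizeProof (lines Data.Product., _) = sizeLines lines

HasProofOfSize≤ : Seq → ℕ → Set
HasProofOfSize≤ S b = Σ (ProofOf S) λ π → sizeProof π ≤ b

tSeq : List PVar → List PVar → ℤ → Seq
tSeq ps qs k = (ext ps k ∷ []) ⇒ (ext qs k ∷ [])

-- The proof is by induction on ps, moving q one position at a time.  Both sides of
-- t^{a ∷ ps ++ q ∷ qs}_j unfold once to pd(t_j, a, t_{j-1}), so the claims for ps at j and
-- j - 1 give the claim with a moved to the front on both sides; it remains to swap the two
-- leading variables, t^{a ∷ q ∷ R}_j → t^{q ∷ a ∷ R}_j, which holds because both sides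
-- unfold, in two steps, to the same case analysis over t^R_j, t^R_{j-1}, t^R_{j-2}.  Each step
-- is a proof of constant length over atoms of size O(|ps ++ q ∷ qs| + log |k|), and the
-- induction uses the claims for |ps| + 1 consecutive indices at each of |ps| + 1 levels, so
-- the whole proof has size O(n³) in the size n of the sequent.
--
-- The constant-length proofs are written once as schematic scripts over numbered atoms and
-- are verified by a checker that runs during type checking; a checked script is then
-- instantiated to every choice of atoms.

module Submission where

open import Defs
open import Data.Nat as ℕ using (ℕ; zero; suc; _+_; _*_; _^_; _≤_; _≤′_; _<ᵇ_; z≤n; s≤s)
import Data.Nat.Properties as ℕP
open import Algebra.Properties.CommutativeSemigroup ℕP.+-commutativeSemigroup using (xy∙z≈xz∙y)
open import Data.Integer as ℤ using (ℤ; ∣_∣; 0ℤ; 1ℤ)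
import Data.Integer.Properties as ℤP
open import Data.Nat.Logarithm using (⌊log₂⌋-mono-≤; ⌊log₂[2*b]⌋≡1+⌊log₂b⌋)
open import Data.Nat.Tactic.RingSolver using (solve-∀)
open import Data.Bool using (T)
open import Data.List using (List; []; _∷_; _++_; [_]; map; length; reverse)
open import Data.Nat.ListAction using (sum)
open import Data.List.Properties using (++-assoc; length-++; length-++-sucʳ; length-++-≤ˡ; length-++-≤ʳ)
open import Data.List.Membership.Propositional using (_∈_)
open import Data.List.Relation.Binary.Subset.Propositional using (_⊆_)
import Data.List.Relation.Binary.Permutation.Propositional as ↭
open ↭ using (_↭_)
import Data.List.Relation.Binary.Permutation.Propositional.Properties as ↭P
open import Data.List.Relation.Unary.All as All using (All; []; _∷_)
import Data.List.Relation.Unary.All.Properties as AllP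
open import Data.List.Relation.Unary.Any as Any using (Any; here; there)
import Data.List.Relation.Unary.Any.Properties as AnyP
open import Data.Maybe as Maybe using (Maybe; just; nothing; from-just; _>>=_)
open import Data.Product using (Σ; _×_; _,_; proj₁; proj₂)
open import Data.Sum using (inj₁; inj₂)
open import Data.Unit using (tt)
open import Relation.Nullary using (yes; no)
open import Relation.Nullary.Decidable using (dec⇒maybe)
open import Relation.Binary.PropositionalEquality as ≡ using (_≡_; refl; cong; sym; subst)

-- Schematic proofs and their checker

-- v i and e i are the i-th propositional variable and the i-th atom of an instantiation.
data SForm : Set where
  v   : ℕ → SForm
  e   : ℕ → SForm
  spd : SForm → ℕ → SForm → SForm

SSeq : Set
SSeq = List SForm × List SForm

infix 4 _≈ˢ_
_≈ˢ_ : SSeq → SSeq → Set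
S ≈ˢ T = (proj₁ S ↭ proj₁ T) × (proj₂ S ↭ proj₂ T)

AxiomList : Set
AxiomList = List (ℕ × SForm)

data SInf (axioms : AxiomList) : List SSeq → SSeq → Set where
  init-p : ∀ p → SInf axioms [] ([ v p ] , [ v p ])
  ax-→   : ∀ {i F} → (i , F) ∈ axioms → SInf axioms [] ([ e i ] , [ F ])
  ax-←   : ∀ {i F} → (i , F) ∈ axioms → SInf axioms [] ([ F ] , [ e i ])
  cut    : ∀ Γ Δ A → SInf axioms ((Γ , A ∷ Δ) ∷ (A ∷ Γ , Δ) ∷ []) (Γ , Δ)
  weak-l : ∀ Γ Δ A → SInf axioms [ Γ , Δ ] (A ∷ Γ , Δ)
  weak-r : ∀ Γ Δ A → SInf axioms [ Γ , Δ ] (Γ , A ∷ Δ)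
  pd-l   : ∀ Γ Δ A p B → SInf axioms ((A ∷ Γ , Δ) ∷ (v p ∷ B ∷ Γ , Δ) ∷ []) (spd A p B ∷ Γ , Δ)
  pd-r   : ∀ Γ Δ A p B → SInf axioms ((Γ , A ∷ v p ∷ Δ) ∷ (Γ , A ∷ B ∷ Δ) ∷ []) (Γ , spd A p B ∷ Δ)

infix 4 _∈ˢ_
_∈ˢ_ : SSeq → List SSeq → Set
S ∈ˢ Ls = Any (S ≈ˢ_) Ls

data SDeriv (axioms : AxiomList) (hyps : List SSeq) : List SSeq → Set where
  []  : SDeriv axioms hyps []
  _∷_ : ∀ {S prev} →
        (Σ (List SSeq) λ Ps → Σ SSeq λ C →
           SInf axioms Ps C × All (_∈ˢ prev ++ hyps) Ps × S ≈ˢ C) →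
        SDeriv axioms hyps prev → SDeriv axioms hyps (S ∷ prev)

eqℕ? : (m n : ℕ) → Maybe (m ≡ n)
eqℕ? m n = dec⇒maybe (m ℕ.≟ n)

eqF? : (A B : SForm) → Maybe (A ≡ B)
eqF? (v m) (v n) = Maybe.map (cong v) (eqℕ? m n)
eqF? (e m) (e n) = Maybe.map (cong e) (eqℕ? m n)
eqF? (spd A p B) (spd C r D) with eqF? A C | eqℕ? p r | eqF? B D
... | just refl | just refl | just refl = just refl
... | _         | _         | _         = nothing
eqF? _ _ = nothing

eqAxiom? : (x y : ℕ × SForm) → Maybe (x ≡ y)
eqAxiom? (i , F) (j , G) with eqℕ? i j | eqF? F G
... | just refl | just refl = just refl
... | _         | _         = nothing

member? : (x : ℕ × SForm) (xs : AxiomList) → Maybe (x ∈ xs)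
member? x []       = nothing
member? x (y ∷ xs) with eqAxiom? x y
... | just x≡y = just (here x≡y)
... | nothing  = Maybe.map there (member? x xs)

remove? : (x : SForm) (ys : List SForm) → Maybe (Σ (List SForm) λ zs → ys ↭ x ∷ zs)
remove? x []       = nothing
remove? x (y ∷ ys) with eqF? x y
... | just refl = just (ys , ↭.refl)
... | nothing   = remove? x ys >>= λ (zs , ys↭) →
                    just (y ∷ zs , ↭.trans (↭.prep y ys↭) (↭.swap y x ↭.refl))

perm? : (xs ys : List SForm) → Maybe (xs ↭ ys)
perm? []       []      = just ↭.refl
perm? []       (_ ∷ _) = nothing
perm? (x ∷ xs) ys      = remove? x ys >>= λ (zs , ys↭) →
                         perm? xs zs >>= λ xs↭ → just (↭.trans (↭.prep x xs↭) (↭.↭-sym ys↭))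

seq? : (S T : SSeq) → Maybe (S ≈ˢ T)
seq? (Γ , Δ) (Γ′ , Δ′) = perm? Γ Γ′ >>= λ Γ↭ → perm? Δ Δ′ >>= λ Δ↭ → just (Γ↭ , Δ↭)

find? : (S : SSeq) (Ls : List SSeq) → Maybe (S ∈ˢ Ls)
find? S []       = nothing
find? S (L ∷ Ls) with seq? S L
... | just S≈L = just (here S≈L)
... | nothing  = Maybe.map there (find? S Ls)

findAll? : (Ss Ls : List SSeq) → Maybe (All (_∈ˢ Ls) Ss)
findAll? []       Ls = just []
findAll? (S ∷ Ss) Ls = find? S Ls >>= λ S∈ → findAll? Ss Ls >>= λ Ss∈ → just (S∈ ∷ Ss∈)

-- The rule justifying a line, with the data that cannot be read off the line.
data Rule : Set where
  init        : ℕ → Rule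
  unfold fold : ℕ → SForm → Rule
  cut weakˡ weakʳ : SForm → Rule
  pdˡ pdʳ     : SForm → ℕ → SForm → Rule

infer : (axioms : AxiomList) → Rule → (S : SSeq) →
        Maybe (Σ (List SSeq) λ Ps → Σ SSeq λ C → SInf axioms Ps C × S ≈ˢ C)
infer axioms (init p) S = seq? S _ >>= λ S≈ → just (_ , _ , init-p p , S≈)
infer axioms (unfold i F) S =
  member? (i , F) axioms >>= λ ax → seq? S _ >>= λ S≈ → just (_ , _ , ax-→ ax , S≈)
infer axioms (fold i F) S =
  member? (i , F) axioms >>= λ ax → seq? S _ >>= λ S≈ → just (_ , _ , ax-← ax , S≈)
infer axioms (cut A) (Γ , Δ) = just (_ , _ , cut Γ Δ A , ↭.refl , ↭.refl)
infer axioms (weakˡ A) (Γ , Δ) =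
  remove? A Γ >>= λ (Γ′ , Γ↭) → just (_ , _ , weak-l Γ′ Δ A , Γ↭ , ↭.refl)
infer axioms (weakʳ A) (Γ , Δ) =
  remove? A Δ >>= λ (Δ′ , Δ↭) → just (_ , _ , weak-r Γ Δ′ A , ↭.refl , Δ↭)
infer axioms (pdˡ A p B) (Γ , Δ) =
  remove? (spd A p B) Γ >>= λ (Γ′ , Γ↭) → just (_ , _ , pd-l Γ′ Δ A p B , Γ↭ , ↭.refl)
infer axioms (pdʳ A p B) (Γ , Δ) =
  remove? (spd A p B) Δ >>= λ (Δ′ , Δ↭) → just (_ , _ , pd-r Γ Δ′ A p B , ↭.refl , Δ↭)

check : (axioms : AxiomList) (hyps : List SSeq) (steps : List (SSeq × Rule)) →
        Maybe (SDeriv axioms hyps (map proj₁ steps))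
check axioms hyps [] = just []
check axioms hyps ((S , r) ∷ steps) =
  check axioms hyps steps >>= λ d →
  infer axioms r S >>= λ (Ps , C , inf , S≈) →
  findAll? Ps (map proj₁ steps ++ hyps) >>= λ Ps∈ →
  just ((Ps , C , inf , Ps∈ , S≈) ∷ d)

infix 4 _∈≈_
_∈≈_ : Seq → List Seq → Set
S ∈≈ Ls = Any (S ≈S_) Ls

≈S-sym : ∀ {S T} → S ≈S T → T ≈S S
≈S-sym (Γ↭ , Δ↭) = ↭.↭-sym Γ↭ , ↭.↭-sym Δ↭

≈S-trans : ∀ {S T U} → S ≈S T → T ≈S U → S ≈S U
≈S-trans (Γ↭ , Δ↭) (Γ↭′ , Δ↭′) = ↭.trans Γ↭ Γ↭′ , ↭.trans Δ↭ Δ↭′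

record Segment (hyps : List Seq) (goal : Seq) : Set where
  field
    lines  : List Seq
    extend : ∀ {base} → All (_∈≈ base) hyps → Deriv base → Deriv (lines ++ base)
    proves : ∀ base → goal ∈≈ lines ++ base
open Segment public

sizeLines-++ : ∀ Ls Ls′ → sizeLines (Ls ++ Ls′) ≡ sizeLines Ls + sizeLines Ls′
sizeLines-++ []       Ls′ = refl
sizeLines-++ (L ∷ Ls) Ls′ =
  ≡.trans (cong (sizeSeq L +_) (sizeLines-++ Ls Ls′)) (sym (ℕP.+-assoc (sizeSeq L) _ _))

weaken : ∀ {hyps hyps′ goal} → hyps′ ⊆ hyps → Segment hyps′ goal → Segment hyps goal
weaken sub s = record
  { lines  = lines s
  ; extend = λ hyps∈ → extend s (All.tabulate λ h∈ → All.lookup hyps∈ (sub h∈))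
  ; proves = proves s
  }

closed : ∀ {hyps goal} → Segment [] goal → Segment hyps goal
closed = weaken λ ()

infixr 5 _▹_
_▹_ : ∀ {hyps goal goal′} → Segment hyps goal → Segment (goal ∷ hyps) goal′ → Segment hyps goal′
s ▹ s′ = record
  { lines  = lines s′ ++ lines s
  ; extend = λ {base} hyps∈ d → subst Deriv (sym (++-assoc (lines s′) (lines s) base))
      (extend s′ (proves s base ∷ All.map (AnyP.++⁺ʳ (lines s)) hyps∈) (extend s hyps∈ d))
  ; proves = λ base → subst (_ ∈≈_) (sym (++-assoc (lines s′) (lines s) base)) (proves s′ (lines s ++ base))
  }

▹-size : ∀ {hyps goal goal′} (s : Segment hyps goal) (s′ : Segment (goal ∷ hyps) goal′) →
         sizeLines (lines (s ▹ s′)) ≡ sizeLines (lines s′) + sizeLines (lines s)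
▹-size s s′ = sizeLines-++ (lines s′) (lines s)

record Script : Set where
  field
    axioms : AxiomList
    hyps   : List SSeq
    steps  : List (SSeq × Rule)
    goal   : SSeq

  derivation : List SSeq
  derivation = map proj₁ (reverse steps)

  Checked : Set
  Checked = SDeriv axioms hyps derivation × goal ∈ˢ derivation

  run : Maybe Checked
  run = check axioms hyps (reverse steps) >>= λ d →
        find? goal derivation >>= λ g → just (d , g)

weightF : SForm → ℕ
weightF (v _)       = 1
weightF (e _)       = 1
weightF (spd A p B) = suc (suc (weightF A + suc (weightF A + weightF B)))

weightS : SSeq → ℕ
weightS (Γ , Δ) = suc (sum (map weightF Γ) + sum (map weightF Δ))

-- Opaque, since unifying against a normalised weight k * M would unfold the product k times.
opaque
  weight : Script → ℕ
  weight sc = sum (map weightS (Script.derivation sc))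

+-scaled : ∀ {x y M} a b → x ≤ a * M → y ≤ b * M → x + y ≤ (a + b) * M
+-scaled {M = M} a b x≤ y≤ = ℕP.≤-trans (ℕP.+-mono-≤ x≤ y≤) (ℕP.≤-reflexive (sym (ℕP.*-distribʳ-+ M a b)))

suc-scaled : ∀ {x M} → 1 ≤ M → ∀ a → x ≤ a * M → suc x ≤ suc a * M
suc-scaled 1≤M a x≤ = ℕP.+-mono-≤ 1≤M x≤

module Instantiation (ρv : ℕ → PVar) (ρe : ℕ → Form) where

  instF : SForm → Form
  instF (v i)       = var (ρv i)
  instF (e i)       = ρe i
  instF (spd A p B) = pd (instF A) (ρv p) (instF B)

  instS : SSeq → Seq
  instS (Γ , Δ) = map instF Γ ⇒ map instF Δ

  Axiom : ℕ × SForm → Set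
  Axiom (i , F) = TAx (ρe i) (instF F)

  instS-≈ : ∀ {S T} → S ≈ˢ T → instS S ≈S instS T
  instS-≈ (Γ↭ , Δ↭) = ↭P.map⁺ instF Γ↭ , ↭P.map⁺ instF Δ↭

  instS-∈ : ∀ {S Ls} → S ∈ˢ Ls → instS S ∈≈ map instS Ls
  instS-∈ S∈ = AnyP.map⁺ (Any.map instS-≈ S∈)

  instS-∈-hyps : ∀ {S hyps base} → All (_∈≈ base) (map instS hyps) → S ∈ˢ hyps → instS S ∈≈ base
  instS-∈-hyps hyps∈ = All.lookupWith (λ h∈ S≈h → Any.map (≈S-trans (instS-≈ S≈h)) h∈) (AllP.map⁻ hyps∈)

  module _ (positive : ∀ i → Positive (ρe i)) where

    instF-positive : ∀ A → Positive (instF A)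
    instF-positive (v i)       = pos-var (ρv i)
    instF-positive (e i)       = positive i
    instF-positive (spd A p B) = pos-pd (ρv p) (instF-positive A) (instF-positive B)

    instS-positive : ∀ S → PositiveSeq (instS S)
    instS-positive (Γ , Δ) = AllP.map⁺ (All.tabulate λ {A} _ → instF-positive A)
                           , AllP.map⁺ (All.tabulate λ {A} _ → instF-positive A)

    module _ {axioms : AxiomList} (valid : All Axiom axioms) where

      instInf : ∀ {Ps C} → SInf axioms Ps C → Inf (map instS Ps) (instS C)
      instInf (init-p p)       = init-p (ρv p)
      instInf (ax-→ ax)        = ax-→ (All.lookup valid ax)
      instInf (ax-← ax)        = ax-← (All.lookup valid ax)
      instInf (cut Γ Δ A)      = cut (map instF Γ) (map instF Δ) (instF A)
      instInf (weak-l Γ Δ A)   = weak-l (map instF Γ) (map instF Δ) (instF A)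
      instInf (weak-r Γ Δ A)   = weak-r (map instF Γ) (map instF Δ) (instF A)
      instInf (pd-l Γ Δ A p B) = pd-l (map instF Γ) (map instF Δ) (instF A) (ρv p) (instF B)
      instInf (pd-r Γ Δ A p B) = pd-r (map instF Γ) (map instF Δ) (instF A) (ρv p) (instF B)

      module _ {hyps : List SSeq} {base : List Seq} (hyps∈ : All (_∈≈ base) (map instS hyps)) where

        instS-∈-above : ∀ {S} prev → S ∈ˢ prev ++ hyps → instS S ∈≈ map instS prev ++ base
        instS-∈-above prev S∈ with AnyP.++⁻ prev S∈
        ... | inj₁ S∈prev = AnyP.++⁺ˡ (instS-∈ S∈prev)
        ... | inj₂ S∈hyps = AnyP.++⁺ʳ (map instS prev) (instS-∈-hyps hyps∈ S∈hyps)

        instDeriv : ∀ {Ls} → SDeriv axioms hyps Ls → Deriv base → Deriv (map instS Ls ++ base)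
        instDeriv []                                            d = d
        instDeriv (_∷_ {S} {prev} (Ps , C , inf , Ps∈ , S≈) sd) d =
          (instS-positive S , map instS Ps , instS C , instInf inf
            , AllP.map⁺ (All.map (instS-∈-above prev) Ps∈) , instS-≈ S≈)
          ∷ instDeriv sd d

  segment : (sc : Script) → Script.Checked sc → All Axiom (Script.axioms sc) → (∀ i → Positive (ρe i)) →
            Segment (map instS (Script.hyps sc)) (instS (Script.goal sc))
  segment sc (d , g) valid positive = record
    { lines  = map instS (Script.derivation sc)
    ; extend = λ hyps∈ → instDeriv positive valid hyps∈ d
    ; proves = λ base → AnyP.++⁺ˡ (instS-∈ g)
    }

  module _ (M : ℕ) (1≤M : 1 ≤ M) (bounded : ∀ i → sizeF (ρe i) ≤ M) where

    instF-size : ∀ A → sizeF (instF A) ≤ weightF A * M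
    instF-size (v _)       = suc-scaled 1≤M 0 z≤n
    instF-size (e i)       = ℕP.≤-trans (bounded i) (ℕP.m≤m+n M 0)
    instF-size (spd A p B) =
      suc-scaled 1≤M (suc (a + suc (a + b))) (suc-scaled 1≤M (a + suc (a + b))
        (+-scaled a (suc (a + b)) (instF-size A)
          (suc-scaled 1≤M (a + b) (+-scaled a b (instF-size A) (instF-size B)))))
      where
      a = weightF A
      b = weightF B

    instFs-size : ∀ Γ → sizeFs (map instF Γ) ≤ sum (map weightF Γ) * M
    instFs-size []      = z≤n
    instFs-size (A ∷ Γ) = +-scaled (weightF A) _ (instF-size A) (instFs-size Γ)

    instLines-size : ∀ Ls → sizeLines (map instS Ls) ≤ sum (map weightS Ls) * M
    instLines-size []             = z≤n
    instLines-size ((Γ , Δ) ∷ Ls) =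
      +-scaled (suc (γ + δ)) _ (suc-scaled 1≤M (γ + δ) (+-scaled γ δ (instFs-size Γ) (instFs-size Δ)))
        (instLines-size Ls)
      where
      γ = sum (map weightF Γ)
      δ = sum (map weightF Δ)

-- Threshold atoms

infixl 6 _⊖_
_⊖_ : ℤ → ℕ → ℤ
j ⊖ zero  = j
j ⊖ suc t = j ⊖ t ℤ.- 1ℤ

definiens : List PVar → ℤ → Form
definiens []      j with j ℤ.≟ 0ℤ
... | yes _ = 𝟏
... | no  _ = 𝟎
definiens (p ∷ Z) j = pd (ext Z j) p (ext Z (j ℤ.- 1ℤ))

definiens-axiom : ∀ Z j → TAx (ext Z j) (definiens Z j)
definiens-axiom []      j with j ℤ.≟ 0ℤ
... | yes refl = t-nil-0
... | no  j≢0  = t-nil-k j≢0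
definiens-axiom (p ∷ Z) j = t-cons p Z j

definiens-positive : ∀ Z j → Positive (definiens Z j)
definiens-positive []      j with j ℤ.≟ 0ℤ
... | yes _ = pos-1
... | no  _ = pos-0
definiens-positive (p ∷ Z) j = pos-pd p (pos-ext Z j) (pos-ext Z (j ℤ.- 1ℤ))

-- An atom of a proof about t^Z_j: the variable t^Z_{j-t} or its definiens, for a small offset t.
data Atom : Set where
  thr def : List PVar → ℕ → Atom

⟦_⟧ : Atom → ℤ → Form
⟦ thr Z t ⟧ j = ext Z (j ⊖ t)
⟦ def Z t ⟧ j = definiens Z (j ⊖ t)

atom-positive : ∀ a j → Positive (⟦ a ⟧ j)
atom-positive (thr Z t) j = pos-ext Z (j ⊖ t)
atom-positive (def Z t) j = definiens-positive Z (j ⊖ t)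

Fits : ℕ → Atom → Set
Fits N (thr Z t) = length Z ≤ N × T (t <ᵇ 3)
Fits N (def Z t) = length Z ≤ N × T (t <ᵇ 3)

sizeℤ-pred : ∀ j → sizeℤ (j ℤ.- 1ℤ) ≤ suc (sizeℤ j)
sizeℤ-pred j = s≤s (s≤s (ℕP.≤-trans (⌊log₂⌋-mono-≤ ∣j-1∣≤)
  (ℕP.≤-reflexive (⌊log₂[2*b]⌋≡1+⌊log₂b⌋ (suc ∣ j ∣)))))
  where
  ∣j-1∣≤ : suc ∣ j ℤ.- 1ℤ ∣ ≤ 2 * suc ∣ j ∣
  ∣j-1∣≤ = ℕP.≤-trans (s≤s (ℤP.∣i-j∣≤∣i∣+∣j∣ j 1ℤ)) (ℕP.+-monoʳ-≤ (suc ∣ j ∣) (s≤s z≤n))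

sizeℤ-⊖ : ∀ j t → sizeℤ (j ⊖ t) ≤ sizeℤ j + t
sizeℤ-⊖ j zero    = ℕP.m≤m+n (sizeℤ j) 0
sizeℤ-⊖ j (suc t) = ℕP.≤-trans (sizeℤ-pred (j ⊖ t))
  (ℕP.≤-trans (s≤s (sizeℤ-⊖ j t)) (ℕP.≤-reflexive (sym (ℕP.+-suc (sizeℤ j) t))))

thresholdBound : ℕ → ℕ → ℕ
thresholdBound N s = suc (N + (s + 3))

atomBound : ℕ → ℕ → ℕ
atomBound N s = 3 * thresholdBound N s + 3

ext-size : ∀ {N s} Z j t → length Z ≤ N → sizeℤ j ≤ s → t ≤ 3 →
           sizeF (ext Z (j ⊖ t)) ≤ thresholdBound N s
ext-size Z j t Z≤N j≤s t≤3 = s≤s (ℕP.+-mono-≤ Z≤N (ℕP.≤-trans (sizeℤ-⊖ j t) (ℕP.+-mono-≤ j≤s t≤3)))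

pd-size : ∀ E → suc (suc (E + suc (E + E))) ≡ 3 * E + 3
pd-size = solve-∀

threshold≤atomBound : ∀ N s → thresholdBound N s ≤ atomBound N s
threshold≤atomBound N s = ℕP.≤-trans (ℕP.m≤m+n _ _) (ℕP.m≤m+n _ 3)

atom-size : ∀ {N s} a j → Fits N a → sizeℤ j ≤ s → sizeF (⟦ a ⟧ j) ≤ atomBound N s
atom-size {N} {s} (thr Z t) j (Z≤N , t<3) j≤s =
  ℕP.≤-trans (ext-size Z j t Z≤N j≤s (ℕP.<⇒≤ (ℕP.<ᵇ⇒< t 3 t<3))) (threshold≤atomBound N s)
atom-size (def [] t) j _ _ with j ⊖ t ℤ.≟ 0ℤ
... | yes _ = s≤s z≤n
... | no  _ = s≤s z≤n
atom-size {N} {s} (def (p ∷ Z) t) j (Z≤N , t<3) j≤s = ℕP.≤-trans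
  (s≤s (s≤s (ℕP.+-mono-≤ now (s≤s (ℕP.+-mono-≤ now before)))))
  (ℕP.≤-reflexive (pd-size (thresholdBound N s)))
  where
  Z≤N′ = ℕP.≤-trans (ℕP.n≤1+n _) Z≤N
  now = ext-size Z j t Z≤N′ j≤s (ℕP.<⇒≤ (ℕP.<ᵇ⇒< t 3 t<3))
  before = ext-size Z j (suc t) Z≤N′ j≤s (ℕP.<ᵇ⇒< t 3 t<3)

nth : {A : Set} → A → List A → ℕ → A
nth default []       _       = default
nth default (x ∷ xs) zero    = x
nth default (x ∷ xs) (suc i) = nth default xs i

nth-All : ∀ {A : Set} {P : A → Set} {d xs} → P d → All P xs → ∀ i → P (nth d xs i)
nth-All Pd []         _       = Pd
nth-All Pd (Px ∷ Pxs) zero    = Px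
nth-All Pd (Px ∷ Pxs) (suc i) = nth-All Pd Pxs i

module ThresholdInstantiation (vars : List PVar) (atoms : List Atom) (j : ℤ) where
  open Instantiation (nth 0 vars) (λ i → ⟦ nth (thr [] 0) atoms i ⟧ j) public

  -- The argument Script.Checked sc is always given as from-just (Script.run sc), which has
  -- this type exactly when the checker accepts the script.
  scriptSegment : (sc : Script) → Script.Checked sc → All Axiom (Script.axioms sc) →
                  Segment (map instS (Script.hyps sc)) (instS (Script.goal sc))
  scriptSegment sc checked valid = segment sc checked valid λ i → atom-positive (nth (thr [] 0) atoms i) j

  opaque
    unfolding weight

    scriptSegment-size : ∀ {N s} sc → All (Fits N) atoms → sizeℤ j ≤ s →
      sizeLines (map instS (Script.derivation sc)) ≤ weight sc * atomBound N s
    scriptSegment-size {N} {s} sc fits j≤s =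
      instLines-size (atomBound N s) (ℕP.≤-trans (s≤s z≤n) (threshold≤atomBound N s))
        (λ i → atom-size (nth (thr [] 0) atoms i) j (nth-All (z≤n , tt) fits i) j≤s) (Script.derivation sc)

infix 6 _⊢_by_
_⊢_by_ : List SForm → List SForm → Rule → SSeq × Rule
Γ ⊢ Δ by r = (Γ , Δ) , r

-- x ⊢ z, from the earlier lines x ⊢ y and y ⊢ z
chain : SForm → SForm → SForm → List (SSeq × Rule)
chain x y z =
  [ x ] ⊢ y ∷ [ z ] by weakʳ z ∷
  (y ∷ [ x ]) ⊢ [ z ] by weakˡ x ∷
  [ x ] ⊢ [ z ] by cut y ∷ []

-- g₁, g₂ ⊢ z, from the earlier lines g₁, g₂ ⊢ y and y ⊢ z
chain₂ : SForm → SForm → SForm → SForm → List (SSeq × Rule)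
chain₂ g₁ g₂ y z =
  (g₁ ∷ [ g₂ ]) ⊢ y ∷ [ z ] by weakʳ z ∷
  (g₁ ∷ [ y ]) ⊢ [ z ] by weakˡ g₁ ∷
  (g₂ ∷ g₁ ∷ [ y ]) ⊢ [ z ] by weakˡ g₂ ∷
  (g₁ ∷ [ g₂ ]) ⊢ [ z ] by cut y ∷ []

axiomIdentity : ℕ → ℕ → List (SSeq × Rule)
axiomIdentity i d =
  [ e i ] ⊢ [ e d ] by unfold i (e d) ∷
  [ e d ] ⊢ [ e i ] by fold i (e d) ∷
  chain (e i) (e d) (e i)

reflexivityScript : Script
reflexivityScript = record
  { axioms = (0 , e 1) ∷ []
  ; hyps   = []
  ; steps  = axiomIdentity 0 1
  ; goal   = [ e 0 ] , [ e 0 ]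
  }

module Reflexivity (Z : List PVar) (j : ℤ) where
  open ThresholdInstantiation [] (thr Z 0 ∷ def Z 0 ∷ []) j

  reflexivity : Segment [] (tSeq Z Z j)
  reflexivity = scriptSegment reflexivityScript (from-just (Script.run reflexivityScript))
                  (definiens-axiom Z j ∷ [])

  reflexivity-size : ∀ {N s} → length Z ≤ N → sizeℤ j ≤ s →
                     sizeLines (lines reflexivity) ≤ weight reflexivityScript * atomBound N s
  reflexivity-size Z≤N = scriptSegment-size reflexivityScript ((Z≤N , _) ∷ (Z≤N , _) ∷ [])

open Reflexivity public

transitivityScript : Script
transitivityScript = record
  { axioms = []
  ; hyps   = ([ e 0 ] , [ e 1 ]) ∷ ([ e 1 ] , [ e 2 ]) ∷ []
  ; steps  = chain (e 0) (e 1) (e 2)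
  ; goal   = [ e 0 ] , [ e 2 ]
  }

module Transitivity (X Y Z : List PVar) (j : ℤ) where
  open ThresholdInstantiation [] (thr X 0 ∷ thr Y 0 ∷ thr Z 0 ∷ []) j

  transitivity : Segment (tSeq X Y j ∷ tSeq Y Z j ∷ []) (tSeq X Z j)
  transitivity = scriptSegment transitivityScript (from-just (Script.run transitivityScript)) []

  transitivity-size : ∀ {N s} → length X ≤ N → length Y ≤ N → length Z ≤ N → sizeℤ j ≤ s →
                      sizeLines (lines transitivity) ≤ weight transitivityScript * atomBound N s
  transitivity-size X≤N Y≤N Z≤N =
    scriptSegment-size transitivityScript ((X≤N , _) ∷ (Y≤N , _) ∷ (Z≤N , _) ∷ [])

open Transitivity public

-- From t^X_j → t^Y_j and t^X_{j-1} → t^Y_{j-1}: both sides unfold to pd(t_j, a, t_{j-1}).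
transferScript : Script
transferScript = record
  { axioms = (0 , aX⁺) ∷ (5 , aY⁺) ∷ []
  ; hyps   = ([ x₀ ] , [ y₀ ]) ∷ ([ x₁ ] , [ y₁ ]) ∷ []
  ; steps  =
      [ x₀ ] ⊢ (va ∷ [ y₀ ]) by weakʳ va ∷
      [ x₀ ] ⊢ (y₁ ∷ [ y₀ ]) by weakʳ y₁ ∷
      [ x₀ ] ⊢ [ aY⁺ ] by pdʳ y₀ 0 y₁ ∷
      [ va ] ⊢ [ va ] by init 0 ∷
      (x₁ ∷ [ va ]) ⊢ [ va ] by weakˡ x₁ ∷
      (x₁ ∷ [ va ]) ⊢ (y₀ ∷ [ va ]) by weakʳ y₀ ∷
      (va ∷ [ x₁ ]) ⊢ [ y₁ ] by weakˡ va ∷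
      (va ∷ [ x₁ ]) ⊢ (y₀ ∷ [ y₁ ]) by weakʳ y₀ ∷
      (va ∷ [ x₁ ]) ⊢ [ aY⁺ ] by pdʳ y₀ 0 y₁ ∷
      [ aX⁺ ] ⊢ [ aY⁺ ] by pdˡ x₀ 0 x₁ ∷
      [ aX ] ⊢ [ aX⁺ ] by unfold 0 aX⁺ ∷
      [ aY⁺ ] ⊢ [ aY ] by fold 5 aY⁺ ∷
      chain aX aX⁺ aY⁺ ++ chain aX aY⁺ aY
  ; goal   = [ aX ] , [ aY ]
  }
  where
  aX = e 0 ; x₀ = e 1 ; x₁ = e 2 ; y₀ = e 3 ; y₁ = e 4 ; aY = e 5
  va = v 0
  aX⁺ = spd x₀ 0 x₁ ; aY⁺ = spd y₀ 0 y₁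

module Transfer (a : PVar) (X Y : List PVar) (j : ℤ) where
  open ThresholdInstantiation [ a ]
    (thr (a ∷ X) 0 ∷ thr X 0 ∷ thr X 1 ∷ thr Y 0 ∷ thr Y 1 ∷ thr (a ∷ Y) 0 ∷ []) j

  transfer : Segment (tSeq X Y j ∷ tSeq X Y (j ℤ.- 1ℤ) ∷ []) (tSeq (a ∷ X) (a ∷ Y) j)
  transfer = scriptSegment transferScript (from-just (Script.run transferScript))
               (t-cons a X j ∷ t-cons a Y j ∷ [])

  transfer-size : ∀ {N s} → length (a ∷ X) ≤ N → length (a ∷ Y) ≤ N → sizeℤ j ≤ s →
                  sizeLines (lines transfer) ≤ weight transferScript * atomBound N s
  transfer-size aX≤N aY≤N = scriptSegment-size transferScript
    ((aX≤N , _) ∷ (X≤N , _) ∷ (X≤N , _) ∷ (Y≤N , _) ∷ (Y≤N , _) ∷ (aY≤N , _) ∷ [])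
    where
    X≤N = ℕP.≤-trans (ℕP.n≤1+n _) aX≤N
    Y≤N = ℕP.≤-trans (ℕP.n≤1+n _) aY≤N

open Transfer public

-- Unfolding t^{abR}_j and t^{baR}_j twice leaves the same cases over t^R_j, t^R_{j-1}, t^R_{j-2}.
swapScript : Script
swapScript = record
  { axioms = (0 , ab⁺) ∷ (1 , b₀⁺) ∷ (2 , b₁⁺) ∷ (3 , ba⁺) ∷ (4 , a₀⁺) ∷ (5 , a₁⁺)
           ∷ (6 , e 9) ∷ (7 , e 10) ∷ (8 , e 11) ∷ []
  ; hyps   = []
  ; steps  = axiomIdentity 6 9 ++ axiomIdentity 7 10 ++ axiomIdentity 8 11
           ++ r₀⊢ba⁺ ++ r₁⊢a₁ ++ b₀⊢ba⁺ ++ ar₁⊢ba⁺ ++ ar₂⊢a₁ ++ ab₁⊢ba⁺ ++ ab⊢ba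
  ; goal   = [ ab ] , [ ba ]
  }
  where
  ab = e 0 ; b₀ = e 1 ; b₁ = e 2 ; ba = e 3 ; a₀ = e 4 ; a₁ = e 5
  r₀ = e 6 ; r₁ = e 7 ; r₂ = e 8
  va = v 0 ; vb = v 1
  ab⁺ = spd b₀ 0 b₁ ; b₀⁺ = spd r₀ 1 r₁ ; b₁⁺ = spd r₁ 1 r₂
  ba⁺ = spd a₀ 1 a₁ ; a₀⁺ = spd r₀ 0 r₁ ; a₁⁺ = spd r₁ 0 r₂

  r₀⊢ba⁺ r₁⊢a₁ b₀⊢ba⁺ ar₁⊢ba⁺ ar₂⊢a₁ ab₁⊢ba⁺ ab⊢ba : List (SSeq × Rule)
  r₀⊢ba⁺ =
    [ r₀ ] ⊢ (r₀ ∷ [ va ]) by weakʳ va ∷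
    [ r₀ ] ⊢ (r₀ ∷ [ r₁ ]) by weakʳ r₁ ∷
    [ r₀ ] ⊢ [ a₀⁺ ] by pdʳ r₀ 0 r₁ ∷
    [ a₀⁺ ] ⊢ [ a₀ ] by fold 4 a₀⁺ ∷
    chain r₀ a₀⁺ a₀ ++
    [ r₀ ] ⊢ (a₀ ∷ [ vb ]) by weakʳ vb ∷
    [ r₀ ] ⊢ (a₀ ∷ [ a₁ ]) by weakʳ a₁ ∷
    [ r₀ ] ⊢ [ ba⁺ ] by pdʳ a₀ 1 a₁ ∷ []
  r₁⊢a₁ =
    [ r₁ ] ⊢ (r₁ ∷ [ va ]) by weakʳ va ∷
    [ r₁ ] ⊢ (r₁ ∷ [ r₂ ]) by weakʳ r₂ ∷
    [ r₁ ] ⊢ [ a₁⁺ ] by pdʳ r₁ 0 r₂ ∷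
    [ a₁⁺ ] ⊢ [ a₁ ] by fold 5 a₁⁺ ∷
    chain r₁ a₁⁺ a₁
  b₀⊢ba⁺ =
    [ vb ] ⊢ [ vb ] by init 1 ∷
    (vb ∷ [ r₁ ]) ⊢ [ vb ] by weakˡ r₁ ∷
    (vb ∷ [ r₁ ]) ⊢ (a₀ ∷ [ vb ]) by weakʳ a₀ ∷
    (vb ∷ [ r₁ ]) ⊢ [ a₁ ] by weakˡ vb ∷
    (vb ∷ [ r₁ ]) ⊢ (a₀ ∷ [ a₁ ]) by weakʳ a₀ ∷
    (vb ∷ [ r₁ ]) ⊢ [ ba⁺ ] by pdʳ a₀ 1 a₁ ∷
    [ b₀⁺ ] ⊢ [ ba⁺ ] by pdˡ r₀ 1 r₁ ∷
    [ b₀ ] ⊢ [ b₀⁺ ] by unfold 1 b₀⁺ ∷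
    chain b₀ b₀⁺ ba⁺
  ar₁⊢ba⁺ =
    [ va ] ⊢ [ va ] by init 0 ∷
    (va ∷ [ r₁ ]) ⊢ [ va ] by weakˡ r₁ ∷
    (va ∷ [ r₁ ]) ⊢ (r₀ ∷ [ va ]) by weakʳ r₀ ∷
    (va ∷ [ r₁ ]) ⊢ [ r₁ ] by weakˡ va ∷
    (va ∷ [ r₁ ]) ⊢ (r₀ ∷ [ r₁ ]) by weakʳ r₀ ∷
    (va ∷ [ r₁ ]) ⊢ [ a₀⁺ ] by pdʳ r₀ 0 r₁ ∷
    chain₂ va r₁ a₀⁺ a₀ ++
    (va ∷ [ r₁ ]) ⊢ (a₀ ∷ [ vb ]) by weakʳ vb ∷
    (va ∷ [ r₁ ]) ⊢ (a₀ ∷ [ a₁ ]) by weakʳ a₁ ∷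
    (va ∷ [ r₁ ]) ⊢ [ ba⁺ ] by pdʳ a₀ 1 a₁ ∷ []
  ar₂⊢a₁ =
    (va ∷ [ r₂ ]) ⊢ [ va ] by weakˡ r₂ ∷
    (va ∷ [ r₂ ]) ⊢ (r₁ ∷ [ va ]) by weakʳ r₁ ∷
    (va ∷ [ r₂ ]) ⊢ [ r₂ ] by weakˡ va ∷
    (va ∷ [ r₂ ]) ⊢ (r₁ ∷ [ r₂ ]) by weakʳ r₁ ∷
    (va ∷ [ r₂ ]) ⊢ [ a₁⁺ ] by pdʳ r₁ 0 r₂ ∷
    chain₂ va r₂ a₁⁺ a₁
  ab₁⊢ba⁺ =
    (vb ∷ [ r₂ ]) ⊢ [ vb ] by weakˡ r₂ ∷
    (vb ∷ r₂ ∷ [ va ]) ⊢ [ vb ] by weakˡ va ∷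
    (vb ∷ r₂ ∷ [ va ]) ⊢ (a₀ ∷ [ vb ]) by weakʳ a₀ ∷
    (vb ∷ r₂ ∷ [ va ]) ⊢ [ a₁ ] by weakˡ vb ∷
    (vb ∷ r₂ ∷ [ va ]) ⊢ (a₀ ∷ [ a₁ ]) by weakʳ a₀ ∷
    (vb ∷ r₂ ∷ [ va ]) ⊢ [ ba⁺ ] by pdʳ a₀ 1 a₁ ∷
    (b₁⁺ ∷ [ va ]) ⊢ [ ba⁺ ] by pdˡ r₁ 1 r₂ ∷
    [ b₁ ] ⊢ [ b₁⁺ ] by unfold 2 b₁⁺ ∷
    (va ∷ [ b₁ ]) ⊢ [ b₁⁺ ] by weakˡ va ∷
    (va ∷ [ b₁ ]) ⊢ (b₁⁺ ∷ [ ba⁺ ]) by weakʳ ba⁺ ∷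
    (b₁⁺ ∷ va ∷ [ b₁ ]) ⊢ [ ba⁺ ] by weakˡ b₁ ∷
    (va ∷ [ b₁ ]) ⊢ [ ba⁺ ] by cut b₁⁺ ∷ []
  ab⊢ba =
    [ ab⁺ ] ⊢ [ ba⁺ ] by pdˡ b₀ 0 b₁ ∷
    [ ab ] ⊢ [ ab⁺ ] by unfold 0 ab⁺ ∷
    [ ba⁺ ] ⊢ [ ba ] by fold 3 ba⁺ ∷
    chain ab ab⁺ ba⁺ ++ chain ab ba⁺ ba

module Swap (a b : PVar) (R : List PVar) (j : ℤ) where
  open ThresholdInstantiation (a ∷ [ b ])
    ( thr (a ∷ b ∷ R) 0 ∷ thr (b ∷ R) 0 ∷ thr (b ∷ R) 1 ∷ thr (b ∷ a ∷ R) 0 ∷ thr (a ∷ R) 0 ∷ thr (a ∷ R) 1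
    ∷ thr R 0 ∷ thr R 1 ∷ thr R 2 ∷ def R 0 ∷ def R 1 ∷ def R 2 ∷ []) j

  swap : Segment [] (tSeq (a ∷ b ∷ R) (b ∷ a ∷ R) j)
  swap = scriptSegment swapScript (from-just (Script.run swapScript))
    ( t-cons a (b ∷ R) j ∷ t-cons b R j ∷ t-cons b R (j ⊖ 1) ∷ t-cons b (a ∷ R) j ∷ t-cons a R j
    ∷ t-cons a R (j ⊖ 1) ∷ definiens-axiom R j ∷ definiens-axiom R (j ⊖ 1) ∷ definiens-axiom R (j ⊖ 2) ∷ [])

  swap-size : ∀ {N s} → length (a ∷ b ∷ R) ≤ N → sizeℤ j ≤ s →
              sizeLines (lines swap) ≤ weight swapScript * atomBound N s
  swap-size abR≤N = scriptSegment-size swapScript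
    ( (abR≤N , _) ∷ (bR≤N , _) ∷ (bR≤N , _) ∷ (abR≤N , _) ∷ (bR≤N , _) ∷ (bR≤N , _)
    ∷ (R≤N , _) ∷ (R≤N , _) ∷ (R≤N , _) ∷ (R≤N , _) ∷ (R≤N , _) ∷ (R≤N , _) ∷ [])
    where
    bR≤N = ℕP.≤-trans (ℕP.n≤1+n _) abR≤N
    R≤N = ℕP.≤-trans (ℕP.n≤1+n _) bR≤N

open Swap public

⊆-swap : ∀ {A B : Seq} {rest} → A ∷ B ∷ [] ⊆ B ∷ A ∷ rest
⊆-swap (here refl)         = there (here refl)
⊆-swap (there (here refl)) = here refl

infixl 5 _⨾_
_⨾_ : ∀ {hyps X Y Z j} → Segment hyps (tSeq X Y j) → Segment hyps (tSeq Y Z j) → Segment hyps (tSeq X Z j)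
_⨾_ {X = X} {Y} {Z} {j} s s′ = s ▹ weaken there s′ ▹ weaken ⊆-swap (transitivity X Y Z j)

⨾-size : ∀ {hyps X Y Z j} (s : Segment hyps (tSeq X Y j)) (s′ : Segment hyps (tSeq Y Z j)) →
         sizeLines (lines (s ⨾ s′))
           ≡ sizeLines (lines (transitivity X Y Z j)) + sizeLines (lines s′) + sizeLines (lines s)
⨾-size {X = X} {Y} {Z} {j} s s′ =
  ≡.trans (▹-size s (weaken there s′ ▹ weaken ⊆-swap (transitivity X Y Z j)))
          (cong (_+ sizeLines (lines s)) (▹-size (weaken there s′) (weaken ⊆-swap (transitivity X Y Z j))))

-- Moving q along ps

module Layers {hyps : ℕ → List Seq} {goal : ℕ → Seq} (seg : ∀ i → Segment (hyps i) (goal i)) where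

  layers : ℕ → List Seq → List Seq
  layers zero    base = lines (seg zero) ++ base
  layers (suc m) base = lines (seg (suc m)) ++ layers m base

  layers-keeps : ∀ m {S base} → S ∈≈ base → S ∈≈ layers m base
  layers-keeps zero    S∈ = AnyP.++⁺ʳ (lines (seg zero)) S∈
  layers-keeps (suc m) S∈ = AnyP.++⁺ʳ (lines (seg (suc m))) (layers-keeps m S∈)

  layers-proves : ∀ m base {i} → i ≤′ m → goal i ∈≈ layers m base
  layers-proves zero    base ℕ.≤′-refl       = proves (seg zero) base
  layers-proves (suc m) base ℕ.≤′-refl       = proves (seg (suc m)) (layers m base)
  layers-proves (suc m) base (ℕ.≤′-step i≤m) = AnyP.++⁺ʳ (lines (seg (suc m))) (layers-proves m base i≤m)

  layers-deriv : ∀ m {base} → (∀ {i} → i ≤′ m → All (_∈≈ base) (hyps i)) →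
                 Deriv base → Deriv (layers m base)
  layers-deriv zero    hyps∈ d = extend (seg zero) (hyps∈ ℕ.≤′-refl) d
  layers-deriv (suc m) hyps∈ d = extend (seg (suc m)) (All.map (layers-keeps m) (hyps∈ ℕ.≤′-refl))
                                   (layers-deriv m (λ i≤m → hyps∈ (ℕ.≤′-step i≤m)) d)

  layers-size : ∀ m base {B} → (∀ {i} → i ≤′ m → sizeLines (lines (seg i)) ≤ B) →
                sizeLines (layers m base) ≤ suc m * B + sizeLines base
  layers-size zero base {B} seg≤ = ℕP.≤-trans (ℕP.≤-reflexive (sizeLines-++ (lines (seg zero)) base))
    (ℕP.+-monoˡ-≤ (sizeLines base) (ℕP.≤-trans (seg≤ ℕ.≤′-refl) (ℕP.m≤m+n B 0)))
  layers-size (suc m) base {B} seg≤ = ℕP.≤-trans (ℕP.≤-reflexive (sizeLines-++ (lines (seg (suc m))) _))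
    (ℕP.≤-trans (ℕP.+-mono-≤ (seg≤ ℕ.≤′-refl) (layers-size m base λ i≤m → seg≤ (ℕ.≤′-step i≤m)))
      (ℕP.≤-reflexive (sym (ℕP.+-assoc B (suc m * B) (sizeLines base)))))

module Transport {Claim : List PVar → ℤ → Seq} (k : ℤ)
  (base : ∀ j → Segment [] (Claim [] j))
  (step : ∀ a ps j → Segment (Claim ps j ∷ Claim ps (j ℤ.- 1ℤ) ∷ []) (Claim (a ∷ ps) j)) where

  open Layers using (layers; layers-proves; layers-deriv; layers-size)

  -- Claim ps j for all j ∈ {k, k-1, …, k-m}; the step to a ∷ ps needs one more index below.
  proofLines : List PVar → ℕ → List Seq
  proofLines []       m = layers (λ i → base (k ⊖ i)) m []
  proofLines (a ∷ ps) m = layers (λ i → step a ps (k ⊖ i)) m (proofLines ps (suc m))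

  proofLines-proves : ∀ ps m {i} → i ≤′ m → Claim ps (k ⊖ i) ∈≈ proofLines ps m
  proofLines-proves []       m = layers-proves (λ i → base (k ⊖ i)) m []
  proofLines-proves (a ∷ ps) m = layers-proves (λ i → step a ps (k ⊖ i)) m (proofLines ps (suc m))

  proofLines-deriv : ∀ ps m → Deriv (proofLines ps m)
  proofLines-deriv []       m = layers-deriv (λ i → base (k ⊖ i)) m (λ _ → []) []
  proofLines-deriv (a ∷ ps) m = layers-deriv (λ i → step a ps (k ⊖ i)) m
    (λ i≤m → proofLines-proves ps (suc m) (ℕ.≤′-step i≤m) ∷ proofLines-proves ps (suc m) (ℕP.s≤′s i≤m) ∷ [])
    (proofLines-deriv ps (suc m))

  transport : ∀ ps → ProofOf (Claim ps k)
  transport ps = proofLines ps 0 , proofLines-deriv ps 0 , Any.map ≈S-sym (proofLines-proves ps 0 ℕ.≤′-refl)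

  module _ (n B : ℕ)
    (base-size : ∀ {i} → i ≤ n → sizeLines (lines (base (k ⊖ i))) ≤ B)
    (step-size : ∀ a ps {i} → length (a ∷ ps) + i ≤ n → sizeLines (lines (step a ps (k ⊖ i))) ≤ B) where

    proofLines-size : ∀ ps m → length ps + m ≤ n →
                      sizeLines (proofLines ps m) ≤ suc (length ps) * (suc n * B)
    proofLines-size [] m m≤n = ℕP.≤-trans
      (layers-size (λ i → base (k ⊖ i)) m [] λ i≤m → base-size (ℕP.≤-trans (ℕP.≤′⇒≤ i≤m) m≤n))
      (ℕP.+-monoˡ-≤ 0 (ℕP.*-monoˡ-≤ B (s≤s m≤n)))
    proofLines-size (a ∷ ps) m ps+m≤n = ℕP.≤-trans
      (layers-size (λ i → step a ps (k ⊖ i)) m (proofLines ps (suc m))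
        λ i≤m → step-size a ps (ℕP.≤-trans (ℕP.+-monoʳ-≤ (length (a ∷ ps)) (ℕP.≤′⇒≤ i≤m)) ps+m≤n))
      (ℕP.+-mono-≤ (ℕP.*-monoˡ-≤ B (s≤s (ℕP.≤-trans (ℕP.m≤n+m m _) ps+m≤n)))
        (proofLines-size ps (suc m) (ℕP.≤-trans (ℕP.≤-reflexive (ℕP.+-suc (length ps) m)) ps+m≤n)))

    transport-size : ∀ ps → length ps ≤ n → sizeProof (transport ps) ≤ suc (length ps) * (suc n * B)
    transport-size ps ps≤n = proofLines-size ps 0 (ℕP.≤-trans (ℕP.≤-reflexive (ℕP.+-identityʳ _)) ps≤n)

tSeq-size : ∀ A B k → suc (length A + sizeℤ k) ≤ sizeSeq (tSeq A B k)
tSeq-size A B k = ℕP.≤-trans (ℕP.m≤m+n _ 0) (ℕP.≤-trans (ℕP.m≤m+n _ _) (ℕP.n≤1+n _))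

atomBound-mono : ∀ N {s s′} → s ≤ s′ → atomBound N s ≤ atomBound N s′
atomBound-mono N s≤s′ = ℕP.+-monoˡ-≤ 3 (ℕP.*-monoʳ-≤ 3 (s≤s (ℕP.+-monoʳ-≤ N (ℕP.+-monoˡ-≤ 3 s≤s′))))

atomBound-linear : ∀ N s → atomBound N (s + N) + (10 * N + 13 * s + 1) ≡ 16 * suc (N + s)
atomBound-linear N s = expanded N s
  where
  expanded : ∀ N s → 3 * suc (N + (s + N + 3)) + 3 + (10 * N + 13 * s + 1) ≡ 16 * suc (N + s)
  expanded = solve-∀

cube : ∀ K S → S * (S * (K * (16 * S))) ≡ 16 * K * S ^ 3
cube K S = expanded K S
  where
  expanded : ∀ K S → S * (S * (K * (16 * S))) ≡ 16 * K * (S * (S * (S * 1)))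
  expanded = solve-∀

cubic-bound : ∀ K n N s S → n ≤ N → suc (N + s) ≤ S →
              suc n * (suc n * (K * atomBound N (s + n))) ≤ 16 * K * S ^ 3 + 16 * K
cubic-bound K n N s S n≤N N+s<S = ℕP.≤-trans
  (ℕP.*-mono-≤ n<S (ℕP.*-mono-≤ n<S (ℕP.*-monoʳ-≤ K atomBound≤)))
  (ℕP.≤-trans (ℕP.≤-reflexive (cube K S)) (ℕP.m≤m+n _ _))
  where
  n<S : suc n ≤ S
  n<S = ℕP.≤-trans (s≤s (ℕP.≤-trans n≤N (ℕP.m≤m+n N s))) N+s<S
  atomBound≤ : atomBound N (s + n) ≤ 16 * S
  atomBound≤ = ℕP.≤-trans (atomBound-mono N (ℕP.+-monoʳ-≤ s n≤N))
    (ℕP.≤-trans (ℕP.m≤m+n _ _) (ℕP.≤-trans (ℕP.≤-reflexive (atomBound-linear N s)) (ℕP.*-monoʳ-≤ 16 N+s<S)))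

stepWeight : ℕ
stepWeight = weight transitivityScript + weight swapScript + weight transferScript

totalWeight : ℕ
totalWeight = weight reflexivityScript + stepWeight

module Moving (q : PVar) (qs : List PVar) where

  Forward Backward : List PVar → ℤ → Seq
  Forward  ps = tSeq (ps ++ q ∷ qs) (q ∷ ps ++ qs)
  Backward ps = tSeq (q ∷ ps ++ qs) (ps ++ q ∷ qs)

  forward-step : ∀ a ps j → Segment (Forward ps j ∷ Forward ps (j ℤ.- 1ℤ) ∷ []) (Forward (a ∷ ps) j)
  forward-step a ps j = transfer a (ps ++ q ∷ qs) (q ∷ ps ++ qs) j ⨾ closed (swap a q (ps ++ qs) j)

  backward-step : ∀ a ps j → Segment (Backward ps j ∷ Backward ps (j ℤ.- 1ℤ) ∷ []) (Backward (a ∷ ps) j)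
  backward-step a ps j = closed (swap q a (ps ++ qs) j) ⨾ transfer a (q ∷ ps ++ qs) (ps ++ q ∷ qs) j

  module _ {N s : ℕ} (a : PVar) (ps : List PVar) (j : ℤ)
           (aqR≤N : length (a ∷ q ∷ ps ++ qs) ≤ N) (j≤s : sizeℤ j ≤ s) where

    private
      X R : List PVar
      X = ps ++ q ∷ qs
      R = ps ++ qs
      M = atomBound N s
      wt = weight transitivityScript
      ws = weight swapScript
      wf = weight transferScript

    aX≤N : length (a ∷ X) ≤ N
    aX≤N = subst (λ n → suc n ≤ N) (sym (length-++-sucʳ ps q qs)) aqR≤N

    forward-step-size : sizeLines (lines (forward-step a ps j)) ≤ stepWeight * M
    forward-step-size = ℕP.≤-trans
      (ℕP.≤-reflexive (⨾-size (transfer a X (q ∷ R) j) (closed (swap a q R j))))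
      (+-scaled (wt + ws) wf
        (+-scaled wt ws (transitivity-size (a ∷ X) (a ∷ q ∷ R) (q ∷ a ∷ R) j aX≤N aqR≤N aqR≤N j≤s)
                        (swap-size a q R j aqR≤N j≤s))
        (transfer-size a X (q ∷ R) j aX≤N aqR≤N j≤s))

    backward-step-size : sizeLines (lines (backward-step a ps j)) ≤ stepWeight * M
    backward-step-size = ℕP.≤-trans
      (ℕP.≤-reflexive (⨾-size (closed (swap q a R j)) (transfer a (q ∷ R) X j)))
      (ℕP.≤-trans
        (+-scaled (wt + wf) ws
          (+-scaled wt wf (transitivity-size (q ∷ a ∷ R) (a ∷ q ∷ R) (a ∷ X) j aqR≤N aqR≤N aX≤N j≤s)
                          (transfer-size a (q ∷ R) X j aqR≤N aX≤N j≤s))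
          (swap-size q a R j aqR≤N j≤s))
        (ℕP.≤-reflexive (cong (_* M) (xy∙z≈xz∙y wt wf ws))))

  module _ (ps : List PVar) (k : ℤ) where
    open ℕP.≤-Reasoning

    private
      n N : ℕ
      n = length ps
      N = length (ps ++ q ∷ qs)
      M = atomBound N (sizeℤ k + n)

    index-size : ∀ {i} → i ≤ n → sizeℤ (k ⊖ i) ≤ sizeℤ k + n
    index-size i≤n = ℕP.≤-trans (sizeℤ-⊖ k _) (ℕP.+-monoʳ-≤ (sizeℤ k) i≤n)

    step-length : ∀ a ps′ {i} → length (a ∷ ps′) + i ≤ n → length (a ∷ q ∷ ps′ ++ qs) ≤ N
    step-length a ps′ {i} h = begin
      length (a ∷ q ∷ ps′ ++ qs)          ≡⟨ cong suc (sym (length-++-sucʳ ps′ q qs)) ⟩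
      suc (length (ps′ ++ q ∷ qs))        ≡⟨ cong suc (length-++ ps′) ⟩
      length (a ∷ ps′) + length (q ∷ qs)  ≤⟨ ℕP.+-monoˡ-≤ _ (ℕP.≤-trans (ℕP.m≤m+n _ i) h) ⟩
      n + length (q ∷ qs)                 ≡⟨ sym (length-++ ps) ⟩
      N                                   ∎

    base-size : ∀ {i} → i ≤ n → sizeLines (lines (reflexivity (q ∷ qs) (k ⊖ i))) ≤ totalWeight * M
    base-size {i} i≤n = ℕP.≤-trans
      (reflexivity-size (q ∷ qs) (k ⊖ i) (length-++-≤ʳ (q ∷ qs) {ps}) (index-size i≤n))
      (ℕP.*-monoˡ-≤ M (ℕP.m≤m+n (weight reflexivityScript) stepWeight))

    module _ (a : PVar) (ps′ : List PVar) {i : ℕ} (h : length (a ∷ ps′) + i ≤ n) where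

      forward-size : sizeLines (lines (forward-step a ps′ (k ⊖ i))) ≤ totalWeight * M
      forward-size = ℕP.≤-trans
        (forward-step-size a ps′ (k ⊖ i) (step-length a ps′ h) (index-size (ℕP.≤-trans (ℕP.m≤n+m i _) h)))
        (ℕP.*-monoˡ-≤ M (ℕP.m≤n+m stepWeight (weight reflexivityScript)))

      backward-size : sizeLines (lines (backward-step a ps′ (k ⊖ i))) ≤ totalWeight * M
      backward-size = ℕP.≤-trans
        (backward-step-size a ps′ (k ⊖ i) (step-length a ps′ h) (index-size (ℕP.≤-trans (ℕP.m≤n+m i _) h)))
        (ℕP.*-monoˡ-≤ M (ℕP.m≤n+m stepWeight (weight reflexivityScript)))

    moved-forward : HasProofOfSize≤ (Forward ps k)
                      (16 * totalWeight * sizeSeq (Forward ps k) ^ 3 + 16 * totalWeight)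
    moved-forward = transport ps , ℕP.≤-trans
      (transport-size n (totalWeight * M) base-size forward-size ps ℕP.≤-refl)
      (cubic-bound totalWeight n N (sizeℤ k) (sizeSeq (Forward ps k)) (length-++-≤ˡ ps)
        (tSeq-size (ps ++ q ∷ qs) (q ∷ ps ++ qs) k))
      where open Transport k (reflexivity (q ∷ qs)) forward-step

    moved-backward : HasProofOfSize≤ (Backward ps k)
                       (16 * totalWeight * sizeSeq (Backward ps k) ^ 3 + 16 * totalWeight)
    moved-backward = transport ps , ℕP.≤-trans
      (transport-size n (totalWeight * M) base-size backward-size ps ℕP.≤-refl)
      (cubic-bound totalWeight n N (sizeℤ k) (sizeSeq (Backward ps k)) (length-++-≤ˡ ps)
        (subst (λ L → suc (L + sizeℤ k) ≤ sizeSeq (Backward ps k)) (sym (length-++-sucʳ ps q qs))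
          (tSeq-size (q ∷ ps ++ qs) (ps ++ q ∷ qs) k)))
      where open Transport k (reflexivity (q ∷ qs)) backward-step

open Moving using (moved-forward; moved-backward)

mainTheorem17 : Σ ℕ λ c → Σ ℕ λ d →
    (ps qs : List PVar) (q : PVar) (k : ℤ) →
      HasProofOfSize≤ (tSeq (ps ++ (q ∷ qs)) (q ∷ (ps ++ qs)) k)
        (c * sizeSeq (tSeq (ps ++ (q ∷ qs)) (q ∷ (ps ++ qs)) k) ^ d + c)
      × HasProofOfSize≤ (tSeq (q ∷ (ps ++ qs)) (ps ++ (q ∷ qs)) k)
        (c * sizeSeq (tSeq (q ∷ (ps ++ qs)) (ps ++ (q ∷ qs)) k) ^ d + c)
mainTheorem17 = 16 * totalWeight , 3 , λ ps qs q k → moved-forward q qs ps k , moved-backward q qs ps k
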